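{- Let $n\ge1$ and $C_1,C_2\in DC(n)$. There exist $m\ge0$ and a sequence $(C^0,C^1,\dots,C^m)$ of elements of $DC(n)$ with $C^0=C_1$, $C^m=C_2$, such that for every $k\in[m]$ there is an index $i_{k-1}\in[2n-1]$ at which $C^{k-1}$ is switchable and $C^k=Sw^{i_{k-1}}(C^{k-1})$.
   Context: A Dellac configuration of size $n$ is a placement of $2n$ dots in a grid with $n$ columns (indexed $1..n$ left to right) and $2n$ rows (indexed $1..2n$ bottom to top) such that each row has exactly one dot, each column exactly two dots, and each dot in column $j$, row $i$ satisfies $j\le i\le j+n$; $DC(n)$ is their set. Write $e_i$ for the dot in row $i$. For $C\in DC(n)$ and $i\in[2n-1]$, $Sw^i(C)$ is the grid obtained by exchanging the columns of the dots $e_i$ and $e_{i+1}$ (each staying in its row), and $C$ is switchable at $i$ if $Sw^i(C)\in DC(n)$. -}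

module Defs where

open import Data.Nat using (ℕ; zero; suc; _+_; _*_; _≤_; _<_)
open import Data.Fin using (Fin; toℕ)
open import Data.Vec using (Vec; []; _∷_; lookup; _[_]≔_)
open import Relation.Nullary using (yes; no)
open import Data.Nat using (_≟_)
open import Data.Product using (Σ; _×_; _,_; ∃-syntax)
open import Relation.Binary.PropositionalEquality using (_≡_)

-- A grid with n columns and 2n rows in which every row has exactly one dot
-- is encoded as a vector  C : Vec ℕ (2 * n); the entry at position r
-- (r : Fin (2n), 0-based) is the (1-based) column of the dot e_(r+1) in
-- row r+1.  The "each row has exactly one dot" condition is built into
-- this encoding; the column range and the other conditions are in IsDC.

countCol : ∀ {m} → Vec ℕ m → ℕ → ℕ
countCol [] j = 0
countCol (c ∷ cs) j with c ≟ j
... | yes _ = suc (countCol cs j)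
... | no _ = countCol cs j

record IsDC (n : ℕ) (C : Vec ℕ (2 * n)) : Set where
  field
    colRange  : ∀ (r : Fin (2 * n)) → 1 ≤ lookup C r × lookup C r ≤ n
    twoPerCol : ∀ (j : ℕ) → 1 ≤ j → j ≤ n → countCol C j ≡ 2
    dellac    : ∀ (r : Fin (2 * n)) →
                lookup C r ≤ suc (toℕ r) × suc (toℕ r) ≤ lookup C r + n

-- Sw^i for i ∈ [2n-1]: given 0-based rows r and r' with toℕ r' ≡ suc (toℕ r)
-- (i.e. r = row i, r' = row i+1), exchange the columns of e_i and e_{i+1}.
swapRows : ∀ {m} → Vec ℕ m → Fin m → Fin m → Vec ℕ m
swapRows C r r' = (C [ r ]≔ lookup C r') [ r' ]≔ lookup C r

SwitchStep : (n : ℕ) → Vec ℕ (2 * n) → Vec ℕ (2 * n) → Set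
SwitchStep n C C' =
  ∃[ r ] ∃[ r' ] (toℕ r' ≡ suc (toℕ r)
                 × IsDC n (swapRows C r r')
                 × C' ≡ swapRows C r r')

data Chain (n : ℕ) : ∀ {m} → Vec (Vec ℕ (2 * n)) (suc m) → Set where
  single : ∀ C → Chain n (C ∷ [])
  step   : ∀ {m} C C' (rest : Vec (Vec ℕ (2 * n)) m) →
           SwitchStep n C C' → Chain n (C' ∷ rest) → Chain n (C ∷ C' ∷ rest)

module Submission where

-- Call the switch at rows i, i+1 a *descent switch* when the dot e_i lies
-- strictly to the right of e_{i+1}.  The proof rests on three facts.
--  (1) A descent switch of a Dellac configuration is again a Dellac
--      configuration: it moves the larger column one row up and the smaller
--      one row down, which keeps j ≤ i ≤ j + n, and it does not change how
--      many dots each column contains.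
--  (2) Insertion sort turns any column vector into its sorted rearrangement
--      by a sequence of descent switches.
--  (3) A weakly increasing vector is determined by the number of times each
--      value occurs in it; hence all Dellac configurations of size n sort to
--      one and the same configuration, namely (1,1,2,2,…,n,n).
-- Undoing a descent switch is again a switch, so a descent sequence can also
-- be run backwards.  Sorting C₁ forwards and C₂ backwards joins C₁ to C₂;
-- finally such a switch sequence is packaged as a chain of configurations.

open import Defs
open import Data.Nat using (ℕ; suc; _+_; _*_; _≤_; _<_; _≤?_; _≟_)
open import Data.Nat.Properties
open import Algebra.Properties.CommutativeSemigroup +-commutativeSemigroup
  using (x∙yz≈y∙xz)
open import Data.Fin using (Fin; zero; suc; toℕ; fromℕ)
open import Data.Vec using (Vec; []; _∷_; lookup)
open import Data.Vec.Relation.Unary.All using (All; []; _∷_)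
open import Data.Vec.Relation.Unary.All.Properties using (lookup⁻)
open import Data.Vec.Relation.Unary.Linked as Linked using (Linked; []; [-]; _∷_)
open import Data.Product using (Σ; _×_; _,_; proj₁; proj₂; ∃-syntax)
open import Data.Unit using (⊤; tt)
open import Data.Empty using (⊥-elim)
open import Relation.Nullary using (yes; no; ¬_)
open import Relation.Binary using (tri<; tri≈; tri>)
open import Relation.Binary.PropositionalEquality
  using (_≡_; refl; sym; trans; cong; subst)
open import Relation.Binary.Construct.Closure.ReflexiveTransitive
  using (Star; ε; _◅_; _◅◅_; gmap)

data Descent : ∀ {m} → Vec ℕ m → Vec ℕ m → Set where
  here  : ∀ {m a b} {S : Vec ℕ m} → b < a → Descent (a ∷ b ∷ S) (b ∷ a ∷ S)
  there : ∀ {m x} {C D : Vec ℕ m} → Descent C D → Descent (x ∷ C) (x ∷ D)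

descent-is-swap : ∀ {m} {C D : Vec ℕ m} → Descent C D →
  Σ (Fin m) λ r → Σ (Fin m) λ r' →
    toℕ r' ≡ suc (toℕ r) × D ≡ swapRows C r r' × C ≡ swapRows D r r'
descent-is-swap (here _) = zero , suc zero , refl , refl , refl
descent-is-swap (there d) with descent-is-swap d
... | r , r' , adjacent , fwd , bwd =
  suc r , suc r' , cong suc adjacent , cong (_ ∷_) fwd , cong (_ ∷_) bwd

hit : ℕ → ℕ → ℕ
hit x j with x ≟ j
... | yes _ = 1
... | no _ = 0

countCol-∷ : ∀ {m} x (S : Vec ℕ m) j → countCol (x ∷ S) j ≡ hit x j + countCol S j
countCol-∷ x S j with x ≟ j
... | yes _ = refl
... | no _ = refl

countCol-self : ∀ {m} x (S : Vec ℕ m) → ¬ countCol (x ∷ S) x ≡ 0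
countCol-self x S with x ≟ x
... | yes _ = λ ()
... | no x≢x = ⊥-elim (x≢x refl)

descent-countCol : ∀ {m} {C D : Vec ℕ m} → Descent C D → ∀ j → countCol C j ≡ countCol D j
descent-countCol (here {a = a} {b} {S} _) j = begin
  countCol (a ∷ b ∷ S) j             ≡⟨ countCol-∷ a (b ∷ S) j ⟩
  hit a j + countCol (b ∷ S) j       ≡⟨ cong (hit a j +_) (countCol-∷ b S j) ⟩
  hit a j + (hit b j + countCol S j) ≡⟨ x∙yz≈y∙xz (hit a j) (hit b j) (countCol S j) ⟩
  hit b j + (hit a j + countCol S j) ≡⟨ cong (hit b j +_) (sym (countCol-∷ a S j)) ⟩
  hit b j + countCol (a ∷ S) j       ≡⟨ sym (countCol-∷ b (a ∷ S) j) ⟩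
  countCol (b ∷ a ∷ S) j             ∎
  where
  open Relation.Binary.PropositionalEquality.≡-Reasoning
descent-countCol (there {x = x} {C} {D} d) j =
  trans (countCol-∷ x C j)
    (trans (cong (hit x j +_) (descent-countCol d j)) (sym (countCol-∷ x D j)))

Admissible : ℕ → ℕ → ℕ → Set
Admissible n k c = (1 ≤ c × c ≤ n) × (c ≤ suc k × suc k ≤ c + n)

AdmissibleFrom : ℕ → ℕ → ∀ {m} → Vec ℕ m → Set
AdmissibleFrom n k [] = ⊤
AdmissibleFrom n k (c ∷ C) = Admissible n k c × AdmissibleFrom n (suc k) C

admissibleFrom⇒lookup : ∀ n k {m} (C : Vec ℕ m) → AdmissibleFrom n k C →
  ∀ r → Admissible n (toℕ r + k) (lookup C r)
admissibleFrom⇒lookup n k (c ∷ C) (adm , _) zero = adm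
admissibleFrom⇒lookup n k (c ∷ C) (_ , adms) (suc r) =
  subst (λ row → Admissible n row (lookup C r)) (+-suc (toℕ r) k)
    (admissibleFrom⇒lookup n (suc k) C adms r)

lookup⇒admissibleFrom : ∀ n k {m} (C : Vec ℕ m) →
  (∀ r → Admissible n (toℕ r + k) (lookup C r)) → AdmissibleFrom n k C
lookup⇒admissibleFrom n k [] adm = tt
lookup⇒admissibleFrom n k (c ∷ C) adm = adm zero , lookup⇒admissibleFrom n (suc k) C
  (λ r → subst (λ row → Admissible n row (lookup C r)) (sym (+-suc (toℕ r) k)) (adm (suc r)))

isDC⇒admissible : ∀ n C → IsDC n C → AdmissibleFrom n 0 C
isDC⇒admissible n C dc = lookup⇒admissibleFrom n 0 C λ r →
  subst (λ row → Admissible n row (lookup C r)) (sym (+-identityʳ (toℕ r)))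
    (IsDC.colRange dc r , IsDC.dellac dc r)

admissible⇒isDC : ∀ n C → AdmissibleFrom n 0 C →
  (∀ j → 1 ≤ j → j ≤ n → countCol C j ≡ 2) → IsDC n C
admissible⇒isDC n C adms twoPerCol = record
  { colRange  = λ r → proj₁ (admissibleAt r)
  ; twoPerCol = twoPerCol
  ; dellac    = λ r → proj₂ (admissibleAt r)
  }
  where
  admissibleAt : ∀ r → Admissible n (toℕ r) (lookup C r)
  admissibleAt r = subst (λ row → Admissible n row (lookup C r)) (+-identityʳ (toℕ r))
    (admissibleFrom⇒lookup n 0 C adms r)

-- Moving the larger column a up a row and the smaller b down a row keeps
-- both admissible: b ≤ a ≤ k+1 and k+2 ≤ b + n ≤ a + n.
descent-admissible : ∀ n k {m} {C D : Vec ℕ m} → Descent C D →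
  AdmissibleFrom n k C → AdmissibleFrom n k D
descent-admissible n k (here {a = a} {b} b<a)
                       ((a-range , a≤k+1 , _) , (b-range , _ , k+2≤b+n) , rest) =
  ((proj₁ b-range , ≤-trans b≤a (proj₂ a-range)) ,
     ≤-trans b≤a a≤k+1 , ≤-trans (n≤1+n (suc k)) k+2≤b+n) ,
  (a-range , m≤n⇒m≤1+n a≤k+1 , ≤-trans k+2≤b+n (+-monoˡ-≤ n b≤a)) ,
  rest
  where
  b≤a : b ≤ a
  b≤a = <⇒≤ b<a
descent-admissible n k (there d) (adm , adms) = adm , descent-admissible n (suc k) d adms

descent-isDC : ∀ n {C D} → Descent C D → IsDC n C → IsDC n D
descent-isDC n {C} {D} d dc =
  admissible⇒isDC n D (descent-admissible n 0 d (isDC⇒admissible n C dc))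
  (λ j 1≤j j≤n → trans (sym (descent-countCol d j)) (IsDC.twoPerCol dc j 1≤j j≤n))

Sorted : ∀ {m} → Vec ℕ m → Set
Sorted = Linked _≤_

insert : ∀ {m} → ℕ → Vec ℕ m → Vec ℕ (suc m)
insert x [] = x ∷ []
insert x (y ∷ ys) with x ≤? y
... | yes _ = x ∷ y ∷ ys
... | no _ = y ∷ insert x ys

sort : ∀ {m} → Vec ℕ m → Vec ℕ m
sort [] = []
sort (x ∷ xs) = insert x (sort xs)

insert-behind-sorted : ∀ {m} y x (ys : Vec ℕ m) → y ≤ x → Sorted (y ∷ ys) → Sorted (y ∷ insert x ys)
insert-behind-sorted y x [] y≤x _ = y≤x ∷ [-]
insert-behind-sorted y x (z ∷ zs) y≤x (y≤z ∷ sorted) with x ≤? z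
... | yes x≤z = y≤x ∷ x≤z ∷ sorted
... | no x≰z = y≤z ∷ insert-behind-sorted z x zs (<⇒≤ (≰⇒> x≰z)) sorted

insert-sorted : ∀ {m} x (ys : Vec ℕ m) → Sorted ys → Sorted (insert x ys)
insert-sorted x [] _ = [-]
insert-sorted x (y ∷ ys) sorted with x ≤? y
... | yes x≤y = x≤y ∷ sorted
... | no x≰y = insert-behind-sorted y x ys (<⇒≤ (≰⇒> x≰y)) sorted

sort-sorted : ∀ {m} (xs : Vec ℕ m) → Sorted (sort xs)
sort-sorted [] = []
sort-sorted (x ∷ xs) = insert-sorted x (sort xs) (sort-sorted xs)

insert-descents : ∀ {m} x (ys : Vec ℕ m) → Star Descent (x ∷ ys) (insert x ys)
insert-descents x [] = ε
insert-descents x (y ∷ ys) with x ≤? y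
... | yes _ = ε
... | no x≰y = here (≰⇒> x≰y) ◅ gmap (y ∷_) there (insert-descents x ys)

sort-descents : ∀ {m} (xs : Vec ℕ m) → Star Descent xs (sort xs)
sort-descents [] = ε
sort-descents (x ∷ xs) = gmap (x ∷_) there (sort-descents xs) ◅◅ insert-descents x (sort xs)

absent-below : ∀ {m z v} {U : Vec ℕ m} → Sorted (z ∷ U) → v < z → countCol (z ∷ U) v ≡ 0
absent-below {z = z} {v} sorted v<z with z ≟ v
... | yes refl = ⊥-elim (<-irrefl refl v<z)
absent-below {U = []} _ _ | no _ = refl
absent-below {U = _ ∷ _} (z≤w ∷ sorted) v<z | no _ = absent-below sorted (<-≤-trans v<z z≤w)

sorted-countCol-unique : ∀ {Q : ℕ → Set} {m} (S T : Vec ℕ m) → Sorted S → Sorted T →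
  All Q S → All Q T → (∀ j → Q j → countCol S j ≡ countCol T j) → S ≡ T
sorted-countCol-unique [] [] _ _ _ _ _ = refl
sorted-countCol-unique (x ∷ S) (y ∷ T) sortedS sortedT (qx ∷ qS) (qy ∷ qT) sameCount
  with <-cmp x y
... | tri< x<y _ _ = ⊥-elim (countCol-self x S
        (trans (sameCount x qx) (absent-below sortedT x<y)))
... | tri> _ _ y<x = ⊥-elim (countCol-self y T
        (trans (sym (sameCount y qy)) (absent-below sortedS y<x)))
... | tri≈ _ refl _ = cong (x ∷_) (sorted-countCol-unique S T
        (Linked.tail sortedS) (Linked.tail sortedT) qS qT
        (λ j qj → +-cancelˡ-≡ (hit x j) _ _
          (trans (sym (countCol-∷ x S j)) (trans (sameCount j qj) (countCol-∷ x T j)))))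

-- All Dellac configurations of size n sort to the same configuration: the
-- sorted vector has entries in [1, n], each occurring exactly twice.
sorted-isDC-unique : ∀ n {S T} → IsDC n S → IsDC n T → Sorted S → Sorted T → S ≡ T
sorted-isDC-unique n {S} {T} dcS dcT sortedS sortedT =
  sorted-countCol-unique {Q = λ c → 1 ≤ c × c ≤ n} S T sortedS sortedT
    (lookup⁻ (IsDC.colRange dcS)) (lookup⁻ (IsDC.colRange dcT))
    (λ j (1≤j , j≤n) → trans (IsDC.twoPerCol dcS j 1≤j j≤n) (sym (IsDC.twoPerCol dcT j 1≤j j≤n)))

Switch : (n : ℕ) → Vec ℕ (2 * n) → Vec ℕ (2 * n) → Set
Switch n C D = IsDC n C × SwitchStep n C D

descent⇒switches : ∀ n {C D} → IsDC n C → Descent C D → Switch n C D × Switch n D C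
descent⇒switches n {C} {D} dcC d with descent-is-swap d
... | r , r' , adjacent , fwd , bwd =
  (dcC , r , r' , adjacent , subst (IsDC n) fwd dcD , fwd) ,
  (dcD , r , r' , adjacent , subst (IsDC n) bwd dcC , bwd)
  where
  dcD : IsDC n D
  dcD = descent-isDC n d dcC

descents⇒switches : ∀ n {C D} → IsDC n C → Star Descent C D →
  IsDC n D × Star (Switch n) C D × Star (Switch n) D C
descents⇒switches n dcC ε = dcC , ε , ε
descents⇒switches n dcC (d ◅ ds)
  with descent⇒switches n dcC d | descents⇒switches n (descent-isDC n d dcC) ds
... | switch , unswitch | dcD , forward , backward =
  dcD , switch ◅ forward , backward ◅◅ (unswitch ◅ ε)

Connected : (n : ℕ) → Vec ℕ (2 * n) → Vec ℕ (2 * n) → Set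
Connected n C₁ C₂ = ∃[ m ] Σ (Vec (Vec ℕ (2 * n)) (suc m)) (λ seq →
  All (IsDC n) seq × lookup seq zero ≡ C₁ × lookup seq (fromℕ m) ≡ C₂ × Chain n seq)

switches⇒connected : ∀ n {C D} → IsDC n D → Star (Switch n) C D → Connected n C D
switches⇒connected n {C} dcD ε = 0 , C ∷ [] , dcD ∷ [] , refl , refl , single C
switches⇒connected n {C} dcD ((dcC , switch) ◅ switches)
  with switches⇒connected n dcD switches
... | m , C' ∷ rest , allDC , refl , ends , chain =
  suc m , C ∷ C' ∷ rest , dcC ∷ allDC , refl , ends , step C C' rest switch chain

-- Sort C₁ forwards and C₂ backwards; both sorted forms coincide.
proposition6 : ∀ (n : ℕ) → 1 ≤ n → ∀ (C₁ C₂ : Vec ℕ (2 * n)) → IsDC n C₁ → IsDC n C₂ →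
    ∃[ m ] Σ (Vec (Vec ℕ (2 * n)) (suc m)) (λ seq →
    All (IsDC n) seq × lookup seq zero ≡ C₁ × lookup seq (fromℕ m) ≡ C₂ × Chain n seq)
proposition6 n _ C₁ C₂ dc₁ dc₂
  with descents⇒switches n dc₁ (sort-descents C₁) | descents⇒switches n dc₂ (sort-descents C₂)
... | sortedDC₁ , sorting₁ , _ | sortedDC₂ , _ , unsorting₂ =
  switches⇒connected n dc₂ (sorting₁ ◅◅ subst (λ S → Star (Switch n) S C₂) (sym sameSort) unsorting₂)
  where
  sameSort : sort C₁ ≡ sort C₂
  sameSort = sorted-isDC-unique n sortedDC₁ sortedDC₂ (sort-sorted C₁) (sort-sorted C₂)
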